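{- A reduced graph contains no induced subgraph isomorphic to $C_\ell^*$ for any $\ell\ge 7$.
   Context: $C_\ell$ is the cycle on $\ell$ vertices, $C_\ell^*$ is $C_\ell$ plus an isolated vertex, and $\overline{H}$ is the complement of $H$. $S_3$ (tent): triangle $a_1a_2a_3$ plus $b_1,b_2,b_3$ with $b_i$ adjacent exactly to $a_i,a_{i+1}$ (indices mod 3); $S_3^*$ is $S_3$ plus an isolated vertex. $F_1$ (long claw): a vertex with three pendant paths each of length $2$ (7 vertices). $F_2$: a 4-cycle $x_1x_2x_3x_4$ with three further vertices, pendant at $x_1$, $x_2$, $x_3$ respectively. $F_3$: a 6-cycle $y_1\cdots y_6$ with chord $y_1y_4$, plus a pendant vertex adjacent only to $y_1$. $F_4$: the same 6-cycle with chord $y_1y_4$, plus a vertex adjacent exactly to $y_1$ and $y_4$. A graph is reduced if it is connected, its complement is connected, and it contains no induced subgraph isomorphic to $C_3^*$, $C_5^*$, $\overline{C_4^*}$, $C_6$, $S_3$, $\overline{S_3^*}$, $F_1$, $F_2$, $F_3$, or $F_4$. -}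

module Defs where

open import Data.Nat using (ℕ; zero; suc; _∸_; _≡ᵇ_)
open import Data.Fin using (Fin; zero; suc; toℕ; _≟_)
open import Data.Bool using (Bool; true; false; not; _∧_; _∨_)
open import Data.Bool.Properties using (∨-comm)
open import Data.List using (List; []; _∷_)
open import Data.Bool.ListAction using (any)
open import Data.Product using (_×_; _,_; Σ)
open import Relation.Nullary using (yes; no; ¬_)
open import Relation.Nullary.Decidable using (⌊_⌋)
open import Relation.Binary.PropositionalEquality using (_≡_; refl; sym; cong₂)
open import Function.Definitions using (Injective)

record Graph : Set where
  field
    n      : ℕ
    adj    : Fin n → Fin n → Bool
    adj-sym    : ∀ u v → adj u v ≡ adj v u
    adj-irrefl : ∀ u → adj u u ≡ false
open Graph public

private
  eqb : ∀ {n} → Fin n → Fin n → Bool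
  eqb u v = ⌊ u ≟ v ⌋

  eqb-sym : ∀ {n} (u v : Fin n) → eqb u v ≡ eqb v u
  eqb-sym u v with u ≟ v | v ≟ u
  ... | yes _ | yes _ = refl
  ... | no _  | no _  = refl
  ... | yes refl | no ¬p = Relation.Nullary.contradiction refl ¬p
    where import Relation.Nullary
  ... | no ¬p | yes refl = Relation.Nullary.contradiction refl ¬p
    where import Relation.Nullary

  eqb-refl : ∀ {n} (u : Fin n) → eqb u u ≡ true
  eqb-refl u with u ≟ u
  ... | yes _ = refl
  ... | no ¬p = Relation.Nullary.contradiction refl ¬p
    where import Relation.Nullary

fromRel : (n : ℕ) → (Fin n → Fin n → Bool) → Graph
fromRel n R = record
  { n = n
  ; adj = λ u v → not (eqb u v) ∧ (R u v ∨ R v u)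
  ; adj-sym = λ u v → cong₂ (λ a b → not a ∧ b) (eqb-sym u v) (∨-comm (R u v) (R v u))
  ; adj-irrefl = λ u → irr u
  }
  where
  irr : ∀ u → not (eqb u u) ∧ (R u u ∨ R u u) ≡ false
  irr u rewrite eqb-refl u = refl

fromEdges : (n : ℕ) → List (ℕ × ℕ) → Graph
fromEdges n es = fromRel n (λ u v → any (λ { (a , b) → (toℕ u ≡ᵇ a) ∧ (toℕ v ≡ᵇ b) }) es)

Cycle : ℕ → Graph
Cycle ℓ = fromRel ℓ (λ u v → (suc (toℕ u) ≡ᵇ toℕ v) ∨ ((toℕ u ≡ᵇ ℓ ∸ 1) ∧ (toℕ v ≡ᵇ 0)))

_* : Graph → Graph
G * = record
  { n = suc (n G)
  ; adj = a
  ; adj-sym = s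
  ; adj-irrefl = i
  }
  where
  a : Fin (suc (n G)) → Fin (suc (n G)) → Bool
  a zero _ = false
  a (suc _) zero = false
  a (suc u) (suc v) = adj G u v
  s : ∀ u v → a u v ≡ a v u
  s zero zero = refl
  s zero (suc _) = refl
  s (suc _) zero = refl
  s (suc u) (suc v) = adj-sym G u v
  i : ∀ u → a u u ≡ false
  i zero = refl
  i (suc u) = adj-irrefl G u

co : Graph → Graph
co G = record
  { n = n G
  ; adj = λ u v → not (eqb u v) ∧ not (adj G u v)
  ; adj-sym = λ u v → cong₂ (λ a b → not a ∧ not b) (eqb-sym u v) (adj-sym G u v)
  ; adj-irrefl = λ u → irr u
  }
  where
  irr : ∀ u → not (eqb u u) ∧ not (adj G u u) ≡ false
  irr u rewrite eqb-refl u = refl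

data Walk (G : Graph) : Fin (n G) → Fin (n G) → Set where
  here : ∀ {u} → Walk G u u
  step : ∀ {u w v} → adj G u w ≡ true → Walk G w v → Walk G u v

Connected : Graph → Set
Connected G = ∀ u v → Walk G u v

record InducedSub (H G : Graph) : Set where
  field
    emb     : Fin (n H) → Fin (n G)
    emb-inj : Injective _≡_ _≡_ emb
    emb-adj : ∀ u v → adj H u v ≡ adj G (emb u) (emb v)

Free : Graph → Graph → Set
Free H G = ¬ InducedSub H G

-- S_3 (tent): a1,a2,a3 = 0,1,2 ; b1,b2,b3 = 3,4,5.
S3 : Graph
S3 = fromEdges 6 ((0 , 1) ∷ (1 , 2) ∷ (2 , 0) ∷ (3 , 0) ∷ (3 , 1) ∷ (4 , 1) ∷ (4 , 2) ∷ (5 , 2) ∷ (5 , 0) ∷ [])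

F1 : Graph
F1 = fromEdges 7 ((0 , 1) ∷ (1 , 2) ∷ (0 , 3) ∷ (3 , 4) ∷ (0 , 5) ∷ (5 , 6) ∷ [])

-- F2: 4-cycle x1x2x3x4 = 0,1,2,3; pendants 4,5,6 at x1,x2,x3.
F2 : Graph
F2 = fromEdges 7 ((0 , 1) ∷ (1 , 2) ∷ (2 , 3) ∷ (3 , 0) ∷ (4 , 0) ∷ (5 , 1) ∷ (6 , 2) ∷ [])

-- F3: 6-cycle y1..y6 = 0..5, chord y1y4 = 03, pendant 6 at y1.
F3 : Graph
F3 = fromEdges 7 ((0 , 1) ∷ (1 , 2) ∷ (2 , 3) ∷ (3 , 4) ∷ (4 , 5) ∷ (5 , 0) ∷ (0 , 3) ∷ (6 , 0) ∷ [])

-- F4: same 6-cycle with chord, vertex 6 adjacent exactly to y1, y4.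
F4 : Graph
F4 = fromEdges 7 ((0 , 1) ∷ (1 , 2) ∷ (2 , 3) ∷ (3 , 4) ∷ (4 , 5) ∷ (5 , 0) ∷ (0 , 3) ∷ (6 , 0) ∷ (6 , 3) ∷ [])

record Reduced (G : Graph) : Set where
  field
    conn    : Connected G
    coConn  : Connected (co G)
    noC3*   : Free (Cycle 3 *) G
    noC5*   : Free (Cycle 5 *) G
    noCoC4* : Free (co (Cycle 4 *)) G
    noC6    : Free (Cycle 6) G
    noS3    : Free S3 G
    noCoS3* : Free (co (S3 *)) G
    noF1    : Free F1 G
    noF2    : Free F2 G
    noF3    : Free F3 G
    noF4    : Free F4 G

-- Suppose G contains C_ℓ* with ℓ ≥ 7. On a walk in G from the isolated vertex
-- to the cycle, the first vertex w with a neighbour on the cycle is entered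
-- from a vertex z with none. Number the cycle cyclically as p₀, p₁, … with
-- w ~ p₃; any five consecutive pᵢ induce a path. If w sees two consecutive pᵢ
-- we find C_3* or the butterfly co(C_4*); otherwise its neighbours among
-- p₀ … p₆, the path and z give F_2 or the long claw F_1.
module Submission where

open import Defs
open import Data.Nat using (ℕ; _≤_)
open import Data.Nat as ℕ using (suc; _+_; _*_; _∸_; _/_; _<_; z≤n; s≤s; NonZero; _≡ᵇ_; _%_)
open import Data.Nat.Properties
  using (≤-trans; <⇒≤; m≤m+n; +-suc; +-assoc; m<n+m; <-irrefl; ∸-monoˡ-<; m+n∸m≡n;
         m+[n∸m]≡n; m≤n⇒m<n∨m≡n; ≮⇒≥; ≡ᵇ⇒≡; ≡⇒≡ᵇ; +-monoˡ-<; <-trans; m+n≤o⇒n≤o)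
open import Data.Nat.DivMod
  using (_mod_; m%n<n; m≡m%n+[m/n]*n; [m+kn]%n≡m%n; m<n⇒m%n≡m; m≤n⇒[n∸m]%m≡n%m; n%n≡0;
         %-remove-+ˡ)
open import Data.Nat.Divisibility using (∣-refl)
open import Data.Fin as Fin using (Fin; zero; suc; toℕ; _≟_)
open import Data.Fin.Properties using (all?; any?; <-cmp; suc-injective; toℕ-injective; toℕ-fromℕ<; toℕ<n)
open import Data.Bool using (Bool; true; false; not; T)
import Data.Bool as Bool
open import Data.Bool.Properties using (¬-not; T-≡; T-∧; T-∨)
open import Data.Empty using (⊥)

open import Data.Product using (∃; ∃₂; _×_; _,_; proj₂)
open import Data.Sum using (_⊎_; inj₁; inj₂)
open import Data.Vec using (Vec; []; _∷_; lookup; tabulate; allFin)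
open import Data.Vec.Relation.Unary.AllPairs using (AllPairs; []; _∷_)
open import Data.Vec.Relation.Unary.All using ([]; _∷_)
import Data.Vec.Relation.Unary.All.Properties as All
open import Function using (_∘_; Equivalence; case_of_)
open import Function.Definitions using (Injective)
open import Level using (0ℓ)
open import Relation.Binary using (tri<; tri≈; tri>)
open import Relation.Binary.PropositionalEquality
  using (_≡_; _≢_; refl; sym; trans; cong; subst; module ≡-Reasoning)
open import Relation.Nullary using (Dec; yes; no; ¬_; contradiction)
open import Relation.Nullary.Decidable using (True; False; toWitness; fromWitnessFalse; _×-dec_; _→-dec_)
open import Relation.Unary using (Pred; Decidable)

open Equivalence using (to; from)

FalseTwins : (H : Graph) → Fin (n H) → Fin (n H) → Set
FalseTwins H u v = adj H u v ≡ false × (∀ y → adj H u y ≡ adj H v y)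

TwinFree : Graph → Set
TwinFree H = ∀ u v → FalseTwins H u v → u ≡ v

falseTwins? : (H : Graph) → ∀ u v → Dec (FalseTwins H u v)
falseTwins? H u v = (adj H u v Bool.≟ false) ×-dec all? (λ y → adj H u y Bool.≟ adj H v y)

twinFree? : (H : Graph) → Dec (TwinFree H)
twinFree? H = all? λ u → all? λ v → falseTwins? H u v →-dec (u ≟ v)

AllPairs-tabulate⁻ : ∀ {a r} {A : Set a} {R : A → A → Set r} {k} {f : Fin k → A} →
                     AllPairs R (tabulate f) → ∀ {i j} → i Fin.< j → R (f i) (f j)
AllPairs-tabulate⁻ {k = suc _} (pxs ∷ _)  {zero}  {suc j} _         = All.tabulate⁻ pxs j
AllPairs-tabulate⁻ {k = suc _} (_ ∷ rest) {suc i} {suc j} (s≤s i<j) = AllPairs-tabulate⁻ rest i<j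

-- A twin-free H embeds as soon as the adjacencies of the listed vertices match
-- those of H on the pairs i < j: agreement forces injectivity, since equal
-- images would be false twins.
induced : ∀ {G} (H : Graph) {twin-free : True (twinFree? H)} (vs : Vec (Fin (n G)) (n H)) →
          AllPairs (λ i j → adj G (lookup vs i) (lookup vs j) ≡ adj H i j) (allFin (n H)) →
          InducedSub H G
induced {G} H {twin-free} vs upper = record { emb = g ; emb-inj = injective ; emb-adj = agree }
  where
  g : Fin (n H) → Fin (n G)
  g = lookup vs

  agree : ∀ u v → adj H u v ≡ adj G (g u) (g v)
  agree u v with <-cmp u v
  ... | tri< u<v _ _ = sym (AllPairs-tabulate⁻ upper u<v)
  ... | tri≈ _ refl _ = trans (adj-irrefl H u) (sym (adj-irrefl G (g u)))
  ... | tri> _ _ v<u =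
    trans (adj-sym H u v) (trans (sym (AllPairs-tabulate⁻ upper v<u)) (adj-sym G (g v) (g u)))

  injective : Injective _≡_ _≡_ g
  injective {u} {v} gu≡gv = toWitness twin-free u v (non-adjacent , same-neighbours)
    where
    non-adjacent : adj H u v ≡ false
    non-adjacent = trans (agree u v) (trans (cong (adj G (g u)) (sym gu≡gv)) (adj-irrefl G (g u)))

    same-neighbours : ∀ y → adj H u y ≡ adj H v y
    same-neighbours y = trans (agree u y) (trans (cong (λ x → adj G x (g y)) gu≡gv) (sym (agree v y)))

unstar : ∀ {H G} → InducedSub (H *) G → InducedSub H G
unstar e = record
  { emb = emb ∘ suc
  ; emb-inj = λ eq → suc-injective (emb-inj eq)
  ; emb-adj = λ u v → emb-adj (suc u) (suc v)
  }
  where open InducedSub e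

walk-crossing : ∀ {G} {P : Pred (Fin (n G)) 0ℓ} → Decidable P → ∀ {u v} → Walk G u v → ¬ P u → P v →
                ∃₂ λ z w → adj G z w ≡ true × ¬ P z × P w
walk-crossing P? here ¬Pu Pv = contradiction Pv ¬Pu
walk-crossing P? (step {w = x} u~x rest) ¬Pu Pv with P? x
... | yes Px = _ , x , u~x , ¬Pu , Px
... | no ¬Px = walk-crossing P? rest ¬Px Pv

record DistanceTwoVertex (G : Graph) {k} (c : Fin k → Fin (n G)) : Set where
  field
    z w : Fin (n G)
    i   : Fin k
    z~w : adj G z w ≡ true
    z≁c : ∀ j → adj G z (c j) ≡ false
    w~c : adj G w (c i) ≡ true

distance-two-vertex : ∀ {G H} → Connected G → (e : InducedSub (H *) G) →
                      ∀ {u v} → adj H u v ≡ true → DistanceTwoVertex G (InducedSub.emb (unstar e))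
distance-two-vertex {G} {H} connected e {u} {v} u~v =
  from-crossing (walk-crossing touches? (connected (emb zero) (c u)) isolated (v , c-adj u~v))
  where
  open InducedSub e
  c : Fin (n H) → Fin (n G)
  c = emb ∘ suc

  c-adj : ∀ {x y} → adj H x y ≡ true → adj G (c x) (c y) ≡ true
  c-adj {x} {y} = trans (sym (emb-adj (suc x) (suc y)))

  Touches : Pred (Fin (n G)) 0ℓ
  Touches x = ∃ λ j → adj G x (c j) ≡ true

  touches? : Decidable Touches
  touches? x = any? λ j → adj G x (c j) Bool.≟ true

  isolated : ¬ Touches (emb zero)
  isolated (j , x~cj) = case trans (emb-adj zero (suc j)) x~cj of λ ()

  from-crossing : (∃₂ λ z w → adj G z w ≡ true × ¬ Touches z × Touches w) → DistanceTwoVertex G c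
  from-crossing (z , w , z~w , ¬Tz , (i , w~ci)) = record
    { z = z ; w = w ; i = i ; z~w = z~w ; z≁c = λ j → ¬-not (λ z~cj → ¬Tz (j , z~cj)) ; w~c = w~ci }

record LocallyInducedPath (G : Graph) (p : ℕ → Fin (n G)) : Set where
  field
    edge : ∀ k → adj G (p k) (p (1 + k)) ≡ true
    gap₂ : ∀ k → adj G (p k) (p (2 + k)) ≡ false
    gap₃ : ∀ k → adj G (p k) (p (3 + k)) ≡ false
    gap₄ : ∀ k → adj G (p k) (p (4 + k)) ≡ false

LocallyInducedPath-along : ∀ {H G p} (e : InducedSub H G) → LocallyInducedPath H p →
                           LocallyInducedPath G (InducedSub.emb e ∘ p)
LocallyInducedPath-along {H} {G} e path = record
  { edge = λ k → transfer (edge k)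
  ; gap₂ = λ k → transfer (gap₂ k)
  ; gap₃ = λ k → transfer (gap₃ k)
  ; gap₄ = λ k → transfer (gap₄ k)
  }
  where
  open InducedSub e
  open LocallyInducedPath path
  transfer : ∀ {x y b} → adj H x y ≡ b → adj G (emb x) (emb y) ≡ b
  transfer {x} {y} = trans (sym (emb-adj x y))

[m+n]%d≡[m+n%d]%d : ∀ m n d .{{_ : NonZero d}} → (m + n) % d ≡ (m + n % d) % d
[m+n]%d≡[m+n%d]%d m n d = begin
  (m + n) % d                    ≡⟨ cong (λ t → (m + t) % d) (m≡m%n+[m/n]*n n d) ⟩
  (m + (n % d + n / d * d)) % d  ≡⟨ cong (_% d) (sym (+-assoc m (n % d) (n / d * d))) ⟩
  (m + n % d + n / d * d) % d    ≡⟨ [m+kn]%n≡m%n (m + n % d) (n / d) d ⟩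
  (m + n % d) % d                ∎
  where
  open ≡-Reasoning

[e+r]%d≢r : ∀ {e d r} .{{_ : NonZero d}} → 0 < e → e < d → r < d → (e + r) % d ≢ r
[e+r]%d≢r {e} {d} {r} 0<e e<d r<d eq with e + r ℕ.<? d
... | yes e+r<d = <-irrefl (sym (trans (sym (m<n⇒m%n≡m e+r<d)) eq)) (m<n+m r 0<e)
... | no e+r≮d = <-irrefl r′≡r r′<r
  where
  d≤e+r : d ≤ e + r
  d≤e+r = ≮⇒≥ e+r≮d
  r′ = e + r ∸ d
  r′<r : r′ < r
  r′<r = subst (r′ <_) (m+n∸m≡n d r) (∸-monoˡ-< (+-monoˡ-< r e<d) d≤e+r)
  r′≡r : r′ ≡ r
  r′≡r = begin
    r′           ≡⟨ sym (m<n⇒m%n≡m (<-trans r′<r r<d)) ⟩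
    r′ % d       ≡⟨ m≤n⇒[n∸m]%m≡n%m d≤e+r ⟩
    (e + r) % d  ≡⟨ eq ⟩
    r            ∎
    where open ≡-Reasoning

[e+m]%d≢m%d : ∀ {e d} .{{_ : NonZero d}} m → 0 < e → e < d → (e + m) % d ≢ m % d
[e+m]%d≢m%d {e} {d} m 0<e e<d eq =
  [e+r]%d≢r 0<e e<d (m%n<n m d) (trans (sym ([m+n]%d≡[m+n%d]%d e m d)) eq)

-- adj (Cycle ℓ) u v unfolds to
-- not ⌊ u ≟ v ⌋ ∧ (cycleStep ℓ (toℕ u) (toℕ v) ∨ cycleStep ℓ (toℕ v) (toℕ u)).
cycleStep : ℕ → ℕ → ℕ → Bool
cycleStep ℓ a b = (suc a ≡ᵇ b) Bool.∨ ((a ≡ᵇ ℓ ∸ 1) Bool.∧ (b ≡ᵇ 0))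

module _ {ℓ : ℕ} .{{_ : NonZero ℓ}} where

  cycleStep-sound : ∀ {a b} → b < ℓ → T (cycleStep ℓ a b) → b ≡ suc a % ℓ
  cycleStep-sound {a} {b} b<ℓ a→b with to T-∨ a→b
  ... | inj₁ 1+a≡ᵇb = trans (sym 1+a≡b) (sym (m<n⇒m%n≡m (subst (_< ℓ) (sym 1+a≡b) b<ℓ)))
    where 1+a≡b = ≡ᵇ⇒≡ (suc a) b 1+a≡ᵇb
  ... | inj₂ wrap with to T-∧ wrap
  ...   | a≡ᵇℓ-1 , b≡ᵇ0 = begin
    b                ≡⟨ ≡ᵇ⇒≡ b 0 b≡ᵇ0 ⟩
    0                ≡⟨ sym (n%n≡0 ℓ) ⟩
    ℓ % ℓ            ≡⟨ cong (_% ℓ) (sym (m+[n∸m]≡n (≤-trans (s≤s z≤n) b<ℓ))) ⟩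
    suc (ℓ ∸ 1) % ℓ  ≡⟨ cong (λ t → suc t % ℓ) (sym (≡ᵇ⇒≡ a (ℓ ∸ 1) a≡ᵇℓ-1)) ⟩
    suc a % ℓ        ∎
    where open ≡-Reasoning

  cycleStep-complete : ∀ {a} → a < ℓ → T (cycleStep ℓ a (suc a % ℓ))
  cycleStep-complete {a} a<ℓ with m≤n⇒m<n∨m≡n a<ℓ
  ... | inj₁ 1+a<ℓ =
    from T-∨ (inj₁ (subst (λ t → T (suc a ≡ᵇ t)) (sym (m<n⇒m%n≡m 1+a<ℓ)) (≡⇒≡ᵇ (suc a) (suc a) refl)))
  ... | inj₂ 1+a≡ℓ = from T-∨ (inj₂ (from T-∧ (≡⇒≡ᵇ a (ℓ ∸ 1) (cong (_∸ 1) 1+a≡ℓ) , wraps-to-0)))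
    where
    wraps-to-0 : T (suc a % ℓ ≡ᵇ 0)
    wraps-to-0 = ≡⇒≡ᵇ (suc a % ℓ) 0 (trans (cong (_% ℓ) 1+a≡ℓ) (n%n≡0 ℓ))

  Cycle-adj⇒ : ∀ {u v : Fin ℓ} → adj (Cycle ℓ) u v ≡ true →
               toℕ v ≡ suc (toℕ u) % ℓ ⊎ toℕ u ≡ suc (toℕ v) % ℓ
  Cycle-adj⇒ {u} {v} u~v with to T-∨ (proj₂ (to T-∧ (from T-≡ u~v)))
  ... | inj₁ forward  = inj₁ (cycleStep-sound {toℕ u} (toℕ<n v) forward)
  ... | inj₂ backward = inj₂ (cycleStep-sound {toℕ v} (toℕ<n u) backward)

  Cycle-adj⇐ : ∀ {u v : Fin ℓ} → u ≢ v → toℕ v ≡ suc (toℕ u) % ℓ → adj (Cycle ℓ) u v ≡ true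
  Cycle-adj⇐ {u} {v} u≢v v≡1+u = to T-≡ (from T-∧ (distinct , from T-∨ (inj₁ succeeds)))
    where
    distinct : False (u ≟ v)
    distinct = fromWitnessFalse u≢v
    succeeds : T (cycleStep ℓ (toℕ u) (toℕ v))
    succeeds = subst (T ∘ cycleStep ℓ (toℕ u)) (sym v≡1+u) (cycleStep-complete (toℕ<n u))

  toℕ-mod : ∀ x → toℕ (x mod ℓ) ≡ x % ℓ
  toℕ-mod x = toℕ-fromℕ< (m%n<n x ℓ)

  mod-≡⇒%-≡ : ∀ {x y} → x mod ℓ ≡ y mod ℓ → x % ℓ ≡ y % ℓ
  mod-≡⇒%-≡ {x} {y} eq = trans (sym (toℕ-mod x)) (trans (cong toℕ eq) (toℕ-mod y))

  toℕ-suc-mod : ∀ x → suc (toℕ (x mod ℓ)) % ℓ ≡ suc x % ℓ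
  toℕ-suc-mod x = trans (cong (λ t → suc t % ℓ) (toℕ-mod x)) (sym ([m+n]%d≡[m+n%d]%d 1 x ℓ))

  Cycle-adj-mod⇒ : ∀ x y → adj (Cycle ℓ) (x mod ℓ) (y mod ℓ) ≡ true →
                   y % ℓ ≡ suc x % ℓ ⊎ x % ℓ ≡ suc y % ℓ
  Cycle-adj-mod⇒ x y x~y with Cycle-adj⇒ x~y
  ... | inj₁ forward  = inj₁ (trans (sym (toℕ-mod y)) (trans forward (toℕ-suc-mod x)))
  ... | inj₂ backward = inj₂ (trans (sym (toℕ-mod x)) (trans backward (toℕ-suc-mod y)))

  cycle-edge : 1 < ℓ → ∀ x → adj (Cycle ℓ) (x mod ℓ) (suc x mod ℓ) ≡ true
  cycle-edge 1<ℓ x = Cycle-adj⇐ distinct (trans (toℕ-mod (suc x)) (sym (toℕ-suc-mod x)))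
    where
    distinct : x mod ℓ ≢ suc x mod ℓ
    distinct eq = [e+m]%d≢m%d x (s≤s z≤n) 1<ℓ (sym (mod-≡⇒%-≡ eq))

  cycle-gap : ∀ d → 2 ≤ d → suc d < ℓ → ∀ x → adj (Cycle ℓ) (x mod ℓ) ((d + x) mod ℓ) ≡ false
  cycle-gap d@(suc (suc d-2)) (s≤s (s≤s z≤n)) d+1<ℓ x =
    ¬-not λ x~d+x → case Cycle-adj-mod⇒ x (d + x) x~d+x of λ where
    (inj₁ forward)  → [e+m]%d≢m%d (suc x) (s≤s z≤n) (m+n≤o⇒n≤o 2 d+1<ℓ)
                        (trans (cong (_% ℓ) (+-suc (suc d-2) x)) forward)
    (inj₂ backward) → [e+m]%d≢m%d x (s≤s z≤n) d+1<ℓ (sym backward)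

  cycle-path : 5 < ℓ → ∀ s → LocallyInducedPath (Cycle ℓ) (λ k → (k + s) mod ℓ)
  cycle-path 5<ℓ s = record
    { edge = λ k → cycle-edge (m+n≤o⇒n≤o 4 5<ℓ) (k + s)
    ; gap₂ = λ k → cycle-gap 2 (s≤s (s≤s z≤n)) (m+n≤o⇒n≤o 2 5<ℓ) (k + s)
    ; gap₃ = λ k → cycle-gap 3 (s≤s (s≤s z≤n)) (m+n≤o⇒n≤o 1 5<ℓ) (k + s)
    ; gap₄ = λ k → cycle-gap 4 (s≤s (s≤s z≤n)) 5<ℓ (k + s)
    }

  mod-rotate : ∀ c → c ≤ ℓ → (i : Fin ℓ) → (c + (ℓ ∸ c + toℕ i)) mod ℓ ≡ i
  mod-rotate c c≤ℓ i = toℕ-injective (begin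
    toℕ ((c + (ℓ ∸ c + toℕ i)) mod ℓ) ≡⟨ toℕ-mod (c + (ℓ ∸ c + toℕ i)) ⟩
    (c + (ℓ ∸ c + toℕ i)) % ℓ         ≡⟨ cong (_% ℓ) (sym (+-assoc c (ℓ ∸ c) (toℕ i))) ⟩
    (c + (ℓ ∸ c) + toℕ i) % ℓ         ≡⟨ cong (λ t → (t + toℕ i) % ℓ) (m+[n∸m]≡n c≤ℓ) ⟩
    (ℓ + toℕ i) % ℓ                   ≡⟨ %-remove-+ˡ (toℕ i) ∣-refl ⟩
    toℕ i % ℓ                         ≡⟨ m<n⇒m%n≡m (toℕ<n i) ⟩
    toℕ i                             ∎)
    where open ≡-Reasoning

module _ {G : Graph} (R : Reduced G) {p : ℕ → Fin (n G)} (path : LocallyInducedPath G p) where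
  open Reduced R
  open LocallyInducedPath path

  adj-swap : ∀ {u v b} → adj G u v ≡ b → adj G v u ≡ b
  adj-swap {u} {v} = trans (adj-sym G v u)

  triangle-on-path⇒⊥ : ∀ {w} j → adj G w (p j) ≡ true → adj G w (p (1 + j)) ≡ true → ⊥
  triangle-on-path⇒⊥ {w} j w~j w~1+j
    with adj G w (p (3 + j)) in w~3+j | adj G w (p (4 + j)) in w~4+j
  ... | false | _ = noC3* (induced (Cycle 3 *) (p (3 + j) ∷ w ∷ p j ∷ p (1 + j) ∷ [])
    ( (adj-swap w~3+j ∷ adj-swap (gap₃ j) ∷ adj-swap (gap₂ (1 + j)) ∷ [])
    ∷ (w~j ∷ w~1+j ∷ [])
    ∷ (edge j ∷ [])
    ∷ [] ∷ []))
  ... | true | false = noC3* (induced (Cycle 3 *) (p (4 + j) ∷ w ∷ p j ∷ p (1 + j) ∷ [])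
    ( (adj-swap w~4+j ∷ adj-swap (gap₄ j) ∷ adj-swap (gap₃ (1 + j)) ∷ [])
    ∷ (w~j ∷ w~1+j ∷ [])
    ∷ (edge j ∷ [])
    ∷ [] ∷ []))
  ... | true | true = noCoC4* (induced (co (Cycle 4 *)) (w ∷ p j ∷ p (3 + j) ∷ p (1 + j) ∷ p (4 + j) ∷ [])
    ( (w~j ∷ w~3+j ∷ w~1+j ∷ w~4+j ∷ [])
    ∷ (gap₃ j ∷ edge j ∷ gap₄ j ∷ [])
    ∷ (adj-swap (gap₂ (1 + j)) ∷ edge (3 + j) ∷ [])
    ∷ (gap₃ (1 + j) ∷ [])
    ∷ [] ∷ []))

  module _ {z w} (z~w : adj G z w ≡ true) (z≁p : ∀ k → adj G z (p k) ≡ false) where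

    square-on-path⇒⊥ : ∀ a → adj G w (p a) ≡ false → adj G w (p (1 + a)) ≡ true →
                       adj G w (p (2 + a)) ≡ false → adj G w (p (3 + a)) ≡ true →
                       adj G w (p (4 + a)) ≡ false → ⊥
    square-on-path⇒⊥ a w≁a w~1+a w≁2+a w~3+a w≁4+a =
      noF2 (induced F2 (p (1 + a) ∷ w ∷ p (3 + a) ∷ p (2 + a) ∷ p a ∷ z ∷ p (4 + a) ∷ [])
        ( (adj-swap w~1+a ∷ gap₂ (1 + a) ∷ edge (1 + a) ∷ adj-swap (edge a) ∷ adj-swap (z≁p (1 + a))
            ∷ gap₃ (1 + a) ∷ [])
        ∷ (w~3+a ∷ w≁2+a ∷ w≁a ∷ adj-swap z~w ∷ w≁4+a ∷ [])
        ∷ (adj-swap (edge (2 + a)) ∷ adj-swap (gap₃ a) ∷ adj-swap (z≁p (3 + a)) ∷ edge (3 + a) ∷ [])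
        ∷ (adj-swap (gap₂ a) ∷ adj-swap (z≁p (2 + a)) ∷ gap₂ (2 + a) ∷ [])
        ∷ (adj-swap (z≁p a) ∷ gap₄ a ∷ [])
        ∷ (z≁p (4 + a) ∷ [])
        ∷ [] ∷ []))

    claw-on-path⇒⊥ : ∀ a → adj G w (p a) ≡ false → adj G w (p (1 + a)) ≡ false →
                     adj G w (p (2 + a)) ≡ true → adj G w (p (3 + a)) ≡ false →
                     adj G w (p (4 + a)) ≡ false → ⊥
    claw-on-path⇒⊥ a w≁a w≁1+a w~2+a w≁3+a w≁4+a =
      noF1 (induced F1 (p (2 + a) ∷ p (1 + a) ∷ p a ∷ p (3 + a) ∷ p (4 + a) ∷ w ∷ z ∷ [])
        ( (adj-swap (edge (1 + a)) ∷ adj-swap (gap₂ a) ∷ edge (2 + a) ∷ gap₂ (2 + a) ∷ adj-swap w~2+a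
            ∷ adj-swap (z≁p (2 + a)) ∷ [])
        ∷ (adj-swap (edge a) ∷ gap₂ (1 + a) ∷ gap₃ (1 + a) ∷ adj-swap w≁1+a ∷ adj-swap (z≁p (1 + a)) ∷ [])
        ∷ (gap₃ a ∷ gap₄ a ∷ adj-swap w≁a ∷ adj-swap (z≁p a) ∷ [])
        ∷ (edge (3 + a) ∷ adj-swap w≁3+a ∷ adj-swap (z≁p (3 + a)) ∷ [])
        ∷ (adj-swap w≁4+a ∷ adj-swap (z≁p (4 + a)) ∷ [])
        ∷ (adj-swap z~w ∷ [])
        ∷ [] ∷ []))

    distance-two⇒⊥ : adj G w (p 3) ≡ true → ⊥
    distance-two⇒⊥ w~3 with adj G w (p 2) in w~2 | adj G w (p 4) in w~4
    ... | true  | _    = triangle-on-path⇒⊥ 2 w~2 w~3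
    ... | false | true = triangle-on-path⇒⊥ 3 w~3 w~4
    ... | false | false with adj G w (p 1) in w~1 | adj G w (p 5) in w~5
    ...   | false | false = claw-on-path⇒⊥ 1 w~1 w~2 w~3 w~4 w~5
    ...   | true  | _     with adj G w (p 0) in w~0
    ...     | true  = triangle-on-path⇒⊥ 0 w~0 w~1
    ...     | false = square-on-path⇒⊥ 0 w~0 w~1 w~2 w~3 w~4
    distance-two⇒⊥ w~3 | false | false | false | true with adj G w (p 6) in w~6
    ... | true  = triangle-on-path⇒⊥ 5 w~5 w~6
    ... | false = square-on-path⇒⊥ 2 w~2 w~3 w~4 w~5 w~6

lemma5p2 : (G : Graph) → Reduced G → (ℓ : ℕ) → 7 ≤ ℓ → Free (Cycle ℓ *) G
lemma5p2 G R ℓ@(suc _) 7≤ℓ C* = distance-two⇒⊥ R path z~w (λ k → z≁c _) w~p₃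
  where
  open DistanceTwoVertex
    (distance-two-vertex (Reduced.conn R) C* {0 mod ℓ} {1 mod ℓ} (cycle-edge (≤-trans (s≤s (s≤s z≤n)) 7≤ℓ) 0))
  open InducedSub (unstar C*)

  s : ℕ
  s = ℓ ∸ 3 + toℕ i

  path : LocallyInducedPath G (λ k → emb ((k + s) mod ℓ))
  path = LocallyInducedPath-along (unstar C*) (cycle-path (<⇒≤ 7≤ℓ) s)

  w~p₃ : adj G w (emb ((3 + s) mod ℓ)) ≡ true
  w~p₃ = subst (λ v → adj G w (emb v) ≡ true) (sym (mod-rotate 3 (≤-trans (m≤m+n 3 4) 7≤ℓ) i)) w~c
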